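{- Let $f,g\in\mathcal{F}$. Then $Sf\in\mathcal{F}$, $f\cdot g\in\mathcal{F}$, and the function \[\langle f,g\rangle(x)=\frac{f(x+1)g(x)+f(x)g(x+1)}{2}\] is integer-valued and belongs to $\mathcal{F}$.
   Context: $(\Delta f)(x)=f(x+1)-f(x)$, $(Sf)(x)=f(x+1)$. $\mathcal{F}$ is the set of functions $f:\mathbb{Z}_{\ge0}\to\mathbb{Z}$ such that $2^n\mid(\Delta^n f)(x)$ for all integers $n\ge0$ and all $x\in\mathbb{Z}_{\ge0}$. -}

module Defs where

open import Data.Nat using (ℕ; zero; suc)
open import Data.Integer using (ℤ; _+_; _-_; _*_; +_)
open import Data.Integer.Divisibility using (_∣_)
open import Data.Nat as N using ()

Δ : (ℕ → ℤ) → (ℕ → ℤ)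
Δ f x = f (suc x) - f x

Δ^ : ℕ → (ℕ → ℤ) → (ℕ → ℤ)
Δ^ zero f = f
Δ^ (suc n) f = Δ (Δ^ n f)

S : (ℕ → ℤ) → (ℕ → ℤ)
S f x = f (suc x)

_·_ : (ℕ → ℤ) → (ℕ → ℤ) → (ℕ → ℤ)
(f · g) x = f x * g x

In𝓕 : (ℕ → ℤ) → Set
In𝓕 f = ∀ (n x : ℕ) → (+ (2 N.^ n)) ∣ Δ^ n f x

-- numerator of ⟨f,g⟩: f(x+1)g(x) + f(x)g(x+1)
pairNum : (ℕ → ℤ) → (ℕ → ℤ) → (ℕ → ℤ)
pairNum f g x = f (suc x) * g x + f x * g (suc x)

module Submission where

-- The whole argument rests on one observation: the difference
-- of f ∈ 𝓕 can be halved inside 𝓕, i.e. Δ f = 2·f' with f' ∈ 𝓕, and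
-- conversely such an f' controls f, because Δ^(n+1) f = Δ^n (Δ f) = 2·Δ^n f'.
-- (f' is the "half-difference" of f.)
--
-- Closure under
-- products follows by induction on n from the discrete Leibniz rule
--   Δ (f·g) = 2·(f'·S g + f·g').
-- Finally ⟨f,g⟩ is the explicit function f·g + f'·g + f·g', since
--   f(x+1)g(x) + f(x)g(x+1) = 2·(f g + f' g + f g')(x),
-- and it lies in 𝓕 by the sum and product closures.

open import Defs
open import Data.Nat using (ℕ; zero; suc; _^_)
open import Data.Integer using (ℤ; _+_; _-_; _*_; +_)
open import Data.Integer.Properties using (pos-*; *-comm)
open import Data.Integer.Divisibility using (_∣_; *-monoʳ-∣; *-cancelˡ-∣)
import Data.Integer.Divisibility.Signed as Signed
open import Data.Integer.Tactic.RingSolver using (solve-∀)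
open import Data.Nat.Divisibility using (1∣_)
open import Data.Product using (_×_; Σ; _,_)
open import Relation.Binary.PropositionalEquality
  using (_≡_; refl; sym; trans; cong₂; subst; module ≡-Reasoning)

open ≡-Reasoning

2^suc : ∀ n → + (2 ^ suc n) ≡ + 2 * + (2 ^ n)
2^suc n = pos-* 2 (2 ^ n)

∣-resp-≡ : ∀ {k k′ a a′ : ℤ} → k ≡ k′ → a ≡ a′ → k ∣ a → k′ ∣ a′
∣-resp-≡ refl refl k∣a = k∣a

Δ^-ext : ∀ {f g : ℕ → ℤ} → (∀ x → f x ≡ g x) → ∀ n x → Δ^ n f x ≡ Δ^ n g x
Δ^-ext f≗g zero    x = f≗g x
Δ^-ext f≗g (suc n) x = cong₂ _-_ (Δ^-ext f≗g n (suc x)) (Δ^-ext f≗g n x)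

Δ^-+ : ∀ (f g : ℕ → ℤ) n x → Δ^ n (λ y → f y + g y) x ≡ Δ^ n f x + Δ^ n g x
Δ^-+ f g zero    x = refl
Δ^-+ f g (suc n) x = begin
  Δ^ n (λ y → f y + g y) (suc x) - Δ^ n (λ y → f y + g y) x
    ≡⟨ cong₂ _-_ (Δ^-+ f g n (suc x)) (Δ^-+ f g n x) ⟩
  (Δ^ n f (suc x) + Δ^ n g (suc x)) - (Δ^ n f x + Δ^ n g x)
    ≡⟨ regroup (Δ^ n f (suc x)) (Δ^ n g (suc x)) (Δ^ n f x) (Δ^ n g x) ⟩
  (Δ^ n f (suc x) - Δ^ n f x) + (Δ^ n g (suc x) - Δ^ n g x) ∎
  where
  regroup : ∀ a b c d → (a + b) - (c + d) ≡ (a - c) + (b - d)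
  regroup = solve-∀

Δ^-scale : ∀ k (f : ℕ → ℤ) n x → Δ^ n (λ y → k * f y) x ≡ k * Δ^ n f x
Δ^-scale k f zero    x = refl
Δ^-scale k f (suc n) x = begin
  Δ^ n (λ y → k * f y) (suc x) - Δ^ n (λ y → k * f y) x
    ≡⟨ cong₂ _-_ (Δ^-scale k f n (suc x)) (Δ^-scale k f n x) ⟩
  k * Δ^ n f (suc x) - k * Δ^ n f x
    ≡⟨ factor k (Δ^ n f (suc x)) (Δ^ n f x) ⟩
  k * (Δ^ n f (suc x) - Δ^ n f x) ∎
  where
  factor : ∀ k a b → k * a - k * b ≡ k * (a - b)
  factor = solve-∀

Δ^-S : ∀ (f : ℕ → ℤ) n x → Δ^ n (S f) x ≡ Δ^ n f (suc x)
Δ^-S f zero    x = refl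
Δ^-S f (suc n) x = cong₂ _-_ (Δ^-S f n (suc x)) (Δ^-S f n x)

Δ^-suc : ∀ (f : ℕ → ℤ) n x → Δ^ (suc n) f x ≡ Δ^ n (Δ f) x
Δ^-suc f zero    x = refl
Δ^-suc f (suc n) x = cong₂ _-_ (Δ^-suc f n (suc x)) (Δ^-suc f n x)

-- If Δ f = 2·g then every higher difference of f is twice one of g.
-- This is what ties divisibility at level n + 1 for f to level n for g.
Δ^-double : ∀ (f g : ℕ → ℤ) → (∀ y → Δ f y ≡ + 2 * g y) →
            ∀ n x → Δ^ (suc n) f x ≡ + 2 * Δ^ n g x
Δ^-double f g Δf≡2g n x = begin
  Δ^ (suc n) f x            ≡⟨ Δ^-suc f n x ⟩
  Δ^ n (Δ f) x              ≡⟨ Δ^-ext Δf≡2g n x ⟩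
  Δ^ n (λ y → + 2 * g y) x  ≡⟨ Δ^-scale (+ 2) g n x ⟩
  + 2 * Δ^ n g x            ∎

-- Membership in 𝓕 read as signed divisibility, whose quotients are integers
-- and which has the library's sum rule.
level : ∀ {f} → In𝓕 f → ∀ n x → + (2 ^ n) Signed.∣ Δ^ n f x
level {f} f∈𝓕 n x = Signed.∣ᵤ⇒∣ {+ (2 ^ n)} {Δ^ n f x} (f∈𝓕 n x)

In𝓕-S : ∀ f → In𝓕 f → In𝓕 (S f)
In𝓕-S f f∈𝓕 n x = subst (+ (2 ^ n) ∣_) (sym (Δ^-S f n x)) (f∈𝓕 n (suc x))

∣-Δ^-+ : ∀ k (f g : ℕ → ℤ) n x → k ∣ Δ^ n f x → k ∣ Δ^ n g x →
         k ∣ Δ^ n (λ y → f y + g y) x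
∣-Δ^-+ k f g n x k∣Δ^f k∣Δ^g = subst (k ∣_) (sym (Δ^-+ f g n x))
  (Signed.∣⇒∣ᵤ (Signed.∣m∣n⇒∣m+n (Signed.∣ᵤ⇒∣ {k} {Δ^ n f x} k∣Δ^f)
                                  (Signed.∣ᵤ⇒∣ {k} {Δ^ n g x} k∣Δ^g)))

In𝓕-+ : ∀ f g → In𝓕 f → In𝓕 g → In𝓕 (λ y → f y + g y)
In𝓕-+ f g f∈𝓕 g∈𝓕 n x = ∣-Δ^-+ (+ (2 ^ n)) f g n x (f∈𝓕 n x) (g∈𝓕 n x)

halfΔ : ∀ f → In𝓕 f → ℕ → ℤ
halfΔ f f∈𝓕 x = Signed.quotient (level f∈𝓕 1 x)

halfΔ-spec : ∀ f (f∈𝓕 : In𝓕 f) x → Δ f x ≡ + 2 * halfΔ f f∈𝓕 x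
halfΔ-spec f f∈𝓕 x =
  trans (Signed._∣_.equality (level f∈𝓕 1 x)) (*-comm (halfΔ f f∈𝓕 x) (+ 2))

-- The half-difference of a member of 𝓕 is again in 𝓕: cancel a factor 2
-- from 2^(n+1) ∣ Δ^(n+1) f = 2·Δ^n f'.
halfΔ-In𝓕 : ∀ f (f∈𝓕 : In𝓕 f) → In𝓕 (halfΔ f f∈𝓕)
halfΔ-In𝓕 f f∈𝓕 n x = *-cancelˡ-∣ (+ 2) {+ (2 ^ n)} {Δ^ n (halfΔ f f∈𝓕) x}
  (∣-resp-≡ (2^suc n) (Δ^-double f (halfΔ f f∈𝓕) (halfΔ-spec f f∈𝓕) n x) (f∈𝓕 (suc n) x))

leibniz : ∀ (f f′ g g′ : ℕ → ℤ) →
          (∀ y → Δ f y ≡ + 2 * f′ y) → (∀ y → Δ g y ≡ + 2 * g′ y) →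
          ∀ y → Δ (f · g) y ≡ + 2 * ((f′ · S g) y + (f · g′) y)
leibniz f f′ g g′ Δf Δg y = begin
  f (suc y) * g (suc y) - f y * g y
    ≡⟨ product-difference (f (suc y)) (f y) (g (suc y)) (g y) ⟩
  Δ f y * g (suc y) + f y * Δ g y
    ≡⟨ cong₂ (λ u v → u * g (suc y) + f y * v) (Δf y) (Δg y) ⟩
  + 2 * f′ y * g (suc y) + f y * (+ 2 * g′ y)
    ≡⟨ factor-two (f′ y) (g (suc y)) (f y) (g′ y) ⟩
  + 2 * (f′ y * g (suc y) + f y * g′ y) ∎
  where
  product-difference : ∀ f₁ f₀ g₁ g₀ →
    f₁ * g₁ - f₀ * g₀ ≡ (f₁ - f₀) * g₁ + f₀ * (g₁ - g₀)
  product-difference = solve-∀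
  factor-two : ∀ a g₁ f₀ b → + 2 * a * g₁ + f₀ * (+ 2 * b) ≡ + 2 * (a * g₁ + f₀ * b)
  factor-two = solve-∀

-- Level n of the product property, by induction on n simultaneously for
-- all pairs: level n + 1 for f·g reduces via the Leibniz rule to level n
-- for f'·S g and f·g'.
In𝓕-·-level : ∀ n f g → In𝓕 f → In𝓕 g → ∀ x → + (2 ^ n) ∣ Δ^ n (f · g) x
In𝓕-·-level zero    f g f∈𝓕 g∈𝓕 x = 1∣ _
In𝓕-·-level (suc n) f g f∈𝓕 g∈𝓕 x =
  ∣-resp-≡ (sym (2^suc n)) (sym (Δ^-double (f · g) H Δ[f·g] n x))
    (*-monoʳ-∣ (+ 2) {+ (2 ^ n)} {Δ^ n H x}
      (∣-Δ^-+ (+ (2 ^ n)) (f′ · S g) (f · g′) n x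
        (In𝓕-·-level n f′ (S g) (halfΔ-In𝓕 f f∈𝓕) (In𝓕-S g g∈𝓕) x)
        (In𝓕-·-level n f g′ f∈𝓕 (halfΔ-In𝓕 g g∈𝓕) x)))
  where
  f′ g′ : ℕ → ℤ
  f′ = halfΔ f f∈𝓕
  g′ = halfΔ g g∈𝓕
  H : ℕ → ℤ
  H y = (f′ · S g) y + (f · g′) y
  Δ[f·g] : ∀ y → Δ (f · g) y ≡ + 2 * H y
  Δ[f·g] = leibniz f f′ g g′ (halfΔ-spec f f∈𝓕) (halfΔ-spec g g∈𝓕)

In𝓕-· : ∀ f g → In𝓕 f → In𝓕 g → In𝓕 (f · g)
In𝓕-· f g f∈𝓕 g∈𝓕 n = In𝓕-·-level n f g f∈𝓕 g∈𝓕

pairNum-halved : ∀ (f f′ g g′ : ℕ → ℤ) →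
                 (∀ y → Δ f y ≡ + 2 * f′ y) → (∀ y → Δ g y ≡ + 2 * g′ y) →
                 ∀ y → + 2 * ((f · g) y + (f′ · g) y + (f · g′) y) ≡ pairNum f g y
pairNum-halved f f′ g g′ Δf Δg y = sym (begin
  f (suc y) * g y + f y * g (suc y)
    ≡⟨ expand (f (suc y)) (f y) (g (suc y)) (g y) ⟩
  Δ f y * g y + f y * Δ g y + + 2 * (f y * g y)
    ≡⟨ cong₂ (λ u v → u * g y + f y * v + + 2 * (f y * g y)) (Δf y) (Δg y) ⟩
  + 2 * f′ y * g y + f y * (+ 2 * g′ y) + + 2 * (f y * g y)
    ≡⟨ factor-two (f′ y) (g y) (f y) (g′ y) ⟩
  + 2 * (f y * g y + f′ y * g y + f y * g′ y) ∎)
  where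
  expand : ∀ f₁ f₀ g₁ g₀ →
    f₁ * g₀ + f₀ * g₁ ≡ (f₁ - f₀) * g₀ + f₀ * (g₁ - g₀) + + 2 * (f₀ * g₀)
  expand = solve-∀
  factor-two : ∀ a g₀ f₀ b →
    + 2 * a * g₀ + f₀ * (+ 2 * b) + + 2 * (f₀ * g₀) ≡ + 2 * (f₀ * g₀ + a * g₀ + f₀ * b)
  factor-two = solve-∀

lemma2p8 : (f g : ℕ → ℤ) → In𝓕 f → In𝓕 g →
    In𝓕 (S f) × In𝓕 (f · g) ×
    Σ (ℕ → ℤ) (λ h → (∀ x → (+ 2) * h x ≡ pairNum f g x) × In𝓕 h)
lemma2p8 f g f∈𝓕 g∈𝓕 =
  In𝓕-S f f∈𝓕 , In𝓕-· f g f∈𝓕 g∈𝓕 , pair , pair-halves , pair∈𝓕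
  where
  f′ g′ : ℕ → ℤ
  f′ = halfΔ f f∈𝓕
  g′ = halfΔ g g∈𝓕
  pair : ℕ → ℤ
  pair y = (f · g) y + (f′ · g) y + (f · g′) y
  pair-halves : ∀ x → + 2 * pair x ≡ pairNum f g x
  pair-halves = pairNum-halved f f′ g g′ (halfΔ-spec f f∈𝓕) (halfΔ-spec g g∈𝓕)
  pair∈𝓕 : In𝓕 pair
  pair∈𝓕 = In𝓕-+ _ _
    (In𝓕-+ _ _ (In𝓕-· f g f∈𝓕 g∈𝓕) (In𝓕-· f′ g (halfΔ-In𝓕 f f∈𝓕) g∈𝓕))
    (In𝓕-· f g′ f∈𝓕 (halfΔ-In𝓕 g g∈𝓕))
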